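{- For any integers $n, d \geq 2$ with $\gcd(d,n) = 1$, we have $\max S_{d,n} = nd - n - d$.
   Context: For integers $d, n \geq 2$, let $n^\ast \in \{1, \dots, d-1\}$ be the unique integer with $n^\ast \equiv -n \pmod d$, and define $S_{d,n} := \{ n^\ast + jd : j \in \mathbb{Z}_{\geq 0} \text{ and } n^\ast + jd < n(d-1)\}$. -}

module Defs where

open import Data.Nat using (ℕ; _+_; _*_; _∸_; _≤_; _<_; NonZero)
open import Data.Nat.DivMod using (_%_)
open import Data.Product using (Σ; _×_)
open import Relation.Binary.PropositionalEquality using (_≡_)

-- n* : the representative of (-n mod d) computed as (d ∸ n % d) % d.
-- When gcd(d,n) = 1 and d ≥ 2 this is the unique element of {1,…,d-1}
-- congruent to -n modulo d.
nstar : (d n : ℕ) → .{{NonZero d}} → ℕ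
nstar d n = (d ∸ n % d) % d

InS : (d n : ℕ) → .{{NonZero d}} → ℕ → Set
InS d n m = Σ ℕ (λ j → (m ≡ nstar d n + j * d)) × (m < n * (d ∸ 1))

IsMaxS : (d n : ℕ) → .{{NonZero d}} → ℕ → Set
IsMaxS d n m = InS d n m × (∀ m′ → InS d n m′ → m′ ≤ m)

{-# OPTIONS --safe #-}
-- Write n = r + q d with r = n % d.  Coprimality forces r ≥ 1, so n* = d − r, and then
-- n d = (n* + K d) + d + n with K = n − q − 2 ≥ 0.  Hence n (d − 1) = n* + (K + 1) d, so
-- S_{d,n} is the progression n* + j d for j ≤ K, whose last term is n d − n − d.
module Submission where

open import Defs
open import Data.Nat using (ℕ; _+_; _*_; _∸_; _≤_; NonZero)
open import Data.Nat.GCD using (gcd)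
open import Relation.Binary.PropositionalEquality using (_≡_)

open import Data.Nat using (zero; suc; _<_; _/_; _%_; s≤s; z≤n; >-nonZero⁻¹)
open import Data.Nat.Properties
open import Data.Nat.DivMod using (m≡m%n+[m/n]*n; m%n<n; m<n⇒m%n≡m)
open import Data.Nat.Divisibility using (_∣_; m%n≡0⇒n∣m; ∣1⇒≡1; ∣-refl)
open import Data.Nat.GCD using (gcd-greatest)
open import Data.Nat.Solver using (module +-*-Solver)
open import Data.Product using (_,_)
open import Relation.Binary.PropositionalEquality using (refl; sym; trans; cong; subst; module ≡-Reasoning)

gcd≡1⇒n%d>0 : ∀ {d n} .{{_ : NonZero d}} → 2 ≤ d → gcd d n ≡ 1 → 0 < n % d
gcd≡1⇒n%d>0 {d} {n} 2≤d gcd≡1 = n≢0⇒n>0 λ n%d≡0 →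
  <⇒≢ 2≤d (sym (∣1⇒≡1 (subst (d ∣_) gcd≡1 (gcd-greatest ∣-refl (m%n≡0⇒n∣m n d n%d≡0)))))

n%d+nstar≡d : ∀ d n .{{_ : NonZero d}} → 0 < n % d → n % d + nstar d n ≡ d
n%d+nstar≡d d n 0<r = begin
  n % d + (d ∸ n % d) % d ≡⟨ cong (n % d +_) (m<n⇒m%n≡m (∸-monoʳ-< 0<r r≤d)) ⟩
  n % d + (d ∸ n % d)     ≡⟨ m+[n∸m]≡n r≤d ⟩
  d                       ∎
  where
  open ≡-Reasoning
  r≤d : n % d ≤ d
  r≤d = <⇒≤ (m%n<n n d)

2+q≤r+q*d : ∀ {r q d} → 0 < r → 2 ≤ d → 2 ≤ r + q * d → 2 + q ≤ r + q * d
2+q≤r+q*d {q = zero}  _   _   2≤n = 2≤n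
2+q≤r+q*d {r} {q = suc q} {d} 0<r 2≤d _ = +-mono-≤ 0<r (begin
  1 + suc q          ≤⟨ +-monoˡ-≤ (suc q) (s≤s z≤n) ⟩
  suc q + suc q      ≡⟨ cong (suc q +_) (sym (+-identityʳ (suc q))) ⟩
  2 * suc q          ≤⟨ *-monoˡ-≤ (suc q) 2≤d ⟩
  d * suc q          ≡⟨ *-comm d (suc q) ⟩
  suc q * d          ∎)
  where open ≤-Reasoning

s+K*d+d+n≡n*d : ∀ {n d r q s K} → n ≡ r + q * d → r + s ≡ d → 2 + q + K ≡ n →
                s + K * d + d + n ≡ n * d
s+K*d+d+n≡n*d {d = d} {r} {q} {s} {K} n≡r+qd refl refl = begin
  s + K * d + d + (2 + q + K) ≡⟨ cong (s + K * d + d +_) n≡r+qd ⟩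
  s + K * d + d + (r + q * d) ≡⟨ identity r q s K ⟩
  (2 + q + K) * d             ∎
  where
  open ≡-Reasoning
  open +-*-Solver
  identity : ∀ r q s K → s + K * (r + s) + (r + s) + (r + q * (r + s))
                         ≡ (2 + q + K) * (r + s)
  identity = solve 4 (λ r q s K →
    s :+ K :* (r :+ s) :+ (r :+ s) :+ (r :+ q :* (r :+ s))
      := (con 2 :+ q :+ K) :* (r :+ s)) refl

n*[d∸1]≡x+d : ∀ {x d n} → x + d + n ≡ n * d → n * (d ∸ 1) ≡ x + d
n*[d∸1]≡x+d {x} {d} {n} nd≡ = begin
  n * (d ∸ 1)   ≡⟨ *-distribˡ-∸ n d 1 ⟩
  n * d ∸ n * 1 ≡⟨ cong (n * d ∸_) (*-identityʳ n) ⟩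
  n * d ∸ n     ≡⟨ cong (_∸ n) (sym nd≡) ⟩
  x + d + n ∸ n ≡⟨ m+n∸n≡m (x + d) n ⟩
  x + d         ∎
  where open ≡-Reasoning

n*d∸n∸d≡x : ∀ {x d n} → x + d + n ≡ n * d → n * d ∸ n ∸ d ≡ x
n*d∸n∸d≡x {x} {d} {n} nd≡ = begin
  n * d ∸ n ∸ d     ≡⟨ cong (λ m → m ∸ n ∸ d) (sym nd≡) ⟩
  x + d + n ∸ n ∸ d ≡⟨ cong (_∸ d) (m+n∸n≡m (x + d) n) ⟩
  x + d ∸ d         ≡⟨ m+n∸n≡m x d ⟩
  x                 ∎
  where open ≡-Reasoning

last-term-below : ∀ a d K .{{_ : NonZero d}} → a + K * d < a + K * d + d
last-term-below a d K = m<m+n (a + K * d) (>-nonZero⁻¹ d)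

index-bound : ∀ a d K j → a + j * d < a + K * d + d → j ≤ K
index-bound a d K j lt = m<1+n⇒m≤n (*-cancelʳ-< d j (suc K)
  (+-cancelˡ-< a (j * d) (suc K * d) (subst (a + j * d <_) a+[1+K]d lt)))
  where
  a+[1+K]d : a + K * d + d ≡ a + suc K * d
  a+[1+K]d = trans (+-assoc a (K * d) d) (cong (a +_) (+-comm (K * d) d))

isMaxS-progression : ∀ d n .{{_ : NonZero d}} K →
                     n * (d ∸ 1) ≡ nstar d n + K * d + d → IsMaxS d n (nstar d n + K * d)
isMaxS-progression d n K bound =
  ((K , refl) , subst (nstar d n + K * d <_) (sym bound) (last-term-below (nstar d n) d K)) ,
  λ { _ ((j , refl) , lt) →
        +-monoʳ-≤ (nstar d n) (*-monoˡ-≤ d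
          (index-bound (nstar d n) d K j (subst (nstar d n + j * d <_) bound lt))) }

lemma3p3 : (n d : ℕ) → .{{_ : NonZero d}} → 2 ≤ n → 2 ≤ d → gcd d n ≡ 1 →
    IsMaxS d n (n * d ∸ n ∸ d)
lemma3p3 n d 2≤n 2≤d gcd≡1 =
  subst (IsMaxS d n) (sym (n*d∸n∸d≡x {x = nstar d n + K * d} nd≡))
    (isMaxS-progression d n K (n*[d∸1]≡x+d {x = nstar d n + K * d} nd≡))
  where
  r = n % d
  q = n / d
  K = n ∸ (2 + q)
  0<r : 0 < r
  0<r = gcd≡1⇒n%d>0 2≤d gcd≡1
  n≡r+qd : n ≡ r + q * d
  n≡r+qd = m≡m%n+[m/n]*n n d
  2+q≤n : 2 + q ≤ n
  2+q≤n = subst (2 + q ≤_) (sym n≡r+qd) (2+q≤r+q*d 0<r 2≤d (subst (2 ≤_) n≡r+qd 2≤n))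
  nd≡ : nstar d n + K * d + d + n ≡ n * d
  nd≡ = s+K*d+d+n≡n*d {q = q} {K = K} n≡r+qd (n%d+nstar≡d d n 0<r) (m+[n∸m]≡n 2+q≤n)
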